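{- Let $ n, a, a_{1}, \dots , a_{d} \in \mathbb{N} $. If \[ S \left( a; a_{1}, \dots , a_{d} \right) := \sum_{ k \text{ mod } a } f_{1} \left( \frac{k a_{1} }{a } \right) \cdots f_{d} \left( \frac{k a_{d} }{a } \right) \] is of Dedekind type with weight $ \left( m_{1} , \dots , m_{d} \right) $ then \[ \sum_{ b | n } b^{ - m_{1} - \dots - m_{d} } \! \sum_{ r_{1} , \dots , r_{d} \text{ mod } b } \! S \left( ab; \frac{ n }{ b } a_{1} + r_{1} a \ , \ \dots \ , \ \frac{ n }{ b } a_{d} + r_{d} a \right) = \ n \ \sigma_{ d - 1 - m_{1} - \dots - m_{d} } (n) \ S \left( a; a_{1}, \dots , a_{d} \right) \ . \]
   Context: $\mathbb{N}$ denotes the positive integers. For $a, a_1,\dots,a_d \in \mathbb{N}$, a sum $S(a;a_1,\dots,a_d) := \sum_{k \text{ mod } a} f_1\left(\frac{k a_1}{a}\right)\cdots f_d\left(\frac{k a_d}{a}\right)$ is said to be of Dedekind type with weight $(m_1,\dots,m_d)$ if for all $j=1,\dots,d$ the function $f_j$ satisfies $f_j(x+1)=f_j(x)$ and, for all $a\in\mathbb{N}$, $\sum_{k \text{ mod } a} f_j\left(x+\frac{k}{a}\right) = a^{m_j} f_j(ax)$. Also $\sigma_m(n) := \sum_{d|n} d^m$. -}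

module Defs where

open import Level using (Level; _⊔_) renaming (suc to lsuc)
open import Algebra.Bundles using (CommutativeRing)
open import Data.Nat as ℕ using (ℕ; zero; suc; NonZero)
open import Data.Nat.Divisibility using (_∣?_)
open import Data.Integer as ℤ using (ℤ; +_; -[1+_])
open import Data.Rational as ℚ using (ℚ; 1ℚ)
open import Data.Fin using (Fin; zero; suc)
open import Data.Bool using (if_then_else_)
open import Data.Product using (_×_)
open import Relation.Nullary.Decidable using (⌊_⌋)

embedℕ : ∀ {c ℓ} (R : CommutativeRing c ℓ) → ℕ → CommutativeRing.Carrier R
embedℕ R zero = CommutativeRing.0# R
embedℕ R (suc n) = CommutativeRing._+_ R (CommutativeRing.1# R) (embedℕ R n)

-- A commutative ring in which every positive integer is invertible
-- (i.e. a ℚ-algebra; the complex numbers are the case of the paper).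
record ℚAlgebra (c ℓ : Level) : Set (lsuc (c ⊔ ℓ)) where
  field
    commRing : CommutativeRing c ℓ
    inv : ℕ → CommutativeRing.Carrier commRing
    inv-law : ∀ n → CommutativeRing._≈_ commRing
      (CommutativeRing._*_ commRing (embedℕ commRing (suc n)) (inv (suc n)))
      (CommutativeRing.1# commRing)
  open CommutativeRing commRing public hiding (zero)

  fromℕ : ℕ → Carrier
  fromℕ = embedℕ commRing

  pow : Carrier → ℕ → Carrier
  pow x zero = 1#
  pow x (suc k) = x * pow x k

  ipow : ℕ → ℤ → Carrier
  ipow b (+ k) = pow (fromℕ b) k
  ipow b -[1+ k ] = pow (inv b) (suc k)

  sumTo : ℕ → (ℕ → Carrier) → Carrier
  sumTo zero g = 0#
  sumTo (suc n) g = sumTo n g + g n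

  prodFin : (d : ℕ) → (Fin d → Carrier) → Carrier
  prodFin zero g = 1#
  prodFin (suc d) g = g zero * prodFin d (λ j → g (suc j))

  sumTuples : (d b : ℕ) → ((Fin d → ℕ) → Carrier) → Carrier
  sumTuples zero b g = g (λ ())
  sumTuples (suc d) b g =
    sumTo b (λ r₀ → sumTuples d b (λ r → g (λ { zero → r₀ ; (suc j) → r j })))

  -- Σ_{b ∣ n} g b  (for n ≥ 1: b runs over 1..n)
  sumDivisors : ℕ → ((b : ℕ) → .{{NonZero b}} → Carrier) → Carrier
  sumDivisors n g = sumTo n (λ k → if ⌊ suc k ∣? n ⌋ then g (suc k) else 0#)

  σ : ℤ → ℕ → Carrier
  σ m n = sumDivisors n (λ b → ipow b m)

  S : {d : ℕ} → (Fin d → ℚ → Carrier) → (a : ℕ) → .{{NonZero a}} → (Fin d → ℕ) → Carrier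
  S {d} f a as = sumTo a (λ k → prodFin d (λ j → f j ((+ (k ℕ.* as j)) ℚ./ a)))

  -- f is periodic and satisfies the distribution relation of weight m
  DedekindTypeFun : (ℚ → Carrier) → ℤ → Set ℓ
  DedekindTypeFun f m =
    (∀ x → f (x ℚ.+ 1ℚ) ≈ f x) ×
    (∀ (a : ℕ) .{{_ : NonZero a}} (x : ℚ) →
       sumTo a (λ k → f (x ℚ.+ (+ k) ℚ./ a)) ≈ ipow a m * f ((+ a ℚ./ 1) ℚ.* x))

  -- S(·;…) is of Dedekind type with weight (m_1,…,m_d)
  DedekindType : {d : ℕ} → (Fin d → ℚ → Carrier) → (Fin d → ℤ) → Set ℓ
  DedekindType f m = ∀ j → DedekindTypeFun (f j) (m j)

sumℤ : (d : ℕ) → (Fin d → ℤ) → ℤ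
sumℤ zero m = + 0
sumℤ (suc d) m = m zero ℤ.+ sumℤ d (λ j → m (suc j))

{-# OPTIONS --safe #-}
module Submission where

-- Write M = m₁ + ⋯ + m_d and P(t) = ∏ⱼ fⱼ(t aⱼ / a), so that S(a; a₁, …, a_d) = Σ_{t mod a} P(t).
-- After expanding S(ab; …) and exchanging sums, the term of the left side indexed by b ∣ n and
-- k mod ab is b^(-M) ∏ⱼ Σ_{r mod b} fⱼ(k ((n/b) aⱼ + r a) / (ab)). Put g = gcd(k, b), k = k′ g and
-- b = b′ g. Multiplication by k′ permutes the residues mod b′, so by periodicity the j-th inner sum
-- runs g times over Σ_{s mod b′} fⱼ((k′ (n/b) aⱼ + s a) / (a b′)), which the distribution relation
-- evaluates to b′^(mⱼ) fⱼ(k′ (n/b) aⱼ / a); the whole term becomes g^(d-M) P(k′ n/b).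
-- Now (b, k) ↦ (g, k′ n/b) is a bijection from {b ∣ n, k < ab} onto {g ∣ n, t < (n/g) a}: the inverse
-- splits t and n/g by their gcd. As P has period a, Σ_{t < (n/g) a} P(t) = (n/g) S(a; a₁, …, a_d),
-- so the left side is Σ_{g ∣ n} g^(d-M) (n/g) S(a; a₁, …, a_d) = n σ_{d-1-M}(n) S(a; a₁, …, a_d).

open import Defs
open import Data.Bool using (if_then_else_)
open import Data.Fin using (Fin; zero; suc)
open import Data.Integer as ℤ using (ℤ; +_; -[1+_]; _⊖_)
import Data.Integer.Properties as ℤ
open import Data.Nat as ℕ using (ℕ; zero; suc; pred; NonZero; _<_; _≤_; _/_; _%_; _<?_)
import Data.Nat.Properties as ℕ
open import Data.Nat.Properties using (m*n≢0)
open import Data.Nat.DivMod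
  using (m≡m%n+[m/n]*n; m*n/n≡m; /-congˡ; %-distribˡ-*; m%n%n≡m%n; %-congˡ; [m+kn]%n≡m%n; m%n<n; m<n⇒m%n≡m)
open import Data.Nat.Coprimality using (Coprime; coprime-Bézout)
open import Data.Nat.Divisibility using (_∣_; _∣?_)
open import Data.Product using (_×_; _,_; proj₁; proj₂; ∃-syntax)
open import Data.Product.Properties using (≡-dec)
open import Data.Rational using (ℚ)
open import Function using (_∘_)
open import Level using (0ℓ)
open import Relation.Binary.PropositionalEquality as ≡ using (_≡_)
open import Relation.Binary.Definitions using (DecidableEquality)
open import Relation.Nullary using (Dec; yes; no; ¬_; _×-dec_)
open import Relation.Nullary.Decidable using (does; isYes≗does; dec-true; dec-false)
open import Relation.Unary using (Pred; Decidable; _∩_; U)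
open import Relation.Unary.Properties using (U?)

InBox : ℕ → ℕ → Pred (ℕ × ℕ) 0ℓ
InBox N M (x , y) = x < N × y < M

_≟²_ : DecidableEquality (ℕ × ℕ)
_≟²_ = ≡-dec ℕ._≟_ ℕ._≟_

record Bijection {I J : Set} (A : Pred I 0ℓ) (B : Pred J 0ℓ) : Set where
  field
    to : I → J
    from : J → I
    to-∈ : ∀ {i} → A i → B (to i)
    from-∈ : ∀ {j} → B j → A (from j)
    from∘to : ∀ {i} → A i → from (to i) ≡ i
    to∘from : ∀ {j} → B j → to (from j) ≡ j

module Residues where
  open import Data.Nat using (_+_; _*_)
  open ≡.≡-Reasoning
  open import Data.Nat.GCD using (module Bézout)
  open import Data.Nat.Tactic.RingSolver using (solve-∀)

  m*[n%d]%d≡m*n%d : ∀ m n d .{{_ : NonZero d}} → (m * (n % d)) % d ≡ (m * n) % d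
  m*[n%d]%d≡m*n%d m n d = begin
    (m * (n % d)) % d            ≡⟨ %-distribˡ-* m (n % d) d ⟩
    ((m % d) * (n % d % d)) % d  ≡⟨ ≡.cong (λ r → ((m % d) * r) % d) (m%n%n≡m%n n d) ⟩
    ((m % d) * (n % d)) % d      ≡⟨ %-distribˡ-* m n d ⟨
    (m * n) % d                  ∎

  mod-inverse : ∀ {k b} .{{_ : NonZero b}} → Coprime k b → ∃[ v ] (v * k) % b ≡ 1 % b
  mod-inverse {k} {b} coprime with coprime-Bézout coprime
  ... | Bézout.+- x y 1+yb≡xk = x , (begin
    (x * k) % b     ≡⟨ %-congˡ 1+yb≡xk ⟨
    (1 + y * b) % b ≡⟨ [m+kn]%n≡m%n 1 y b ⟩
    1 % b           ∎)
  mod-inverse {k} {b@(suc c)} coprime | Bézout.-+ x y 1+xk≡yb = c * x , (begin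
    (c * x * k) % b             ≡⟨ [m+kn]%n≡m%n (c * x * k) 1 b ⟨
    (c * x * k + 1 * b) % b     ≡⟨ %-congˡ (identity c x k) ⟩
    (1 + c * (1 + x * k)) % b   ≡⟨ ≡.cong (λ z → (1 + c * z) % b) 1+xk≡yb ⟩
    (1 + c * (y * b)) % b       ≡⟨ ≡.cong (λ z → (1 + z) % b) (ℕ.*-assoc c y b) ⟨
    (1 + c * y * b) % b         ≡⟨ [m+kn]%n≡m%n 1 (c * y) b ⟩
    1 % b                       ∎)
    where
    identity : ∀ c x k → c * x * k + 1 * suc c ≡ 1 + c * (1 + x * k)
    identity = solve-∀

  mod-inverse-cancel : ∀ {u w b} .{{_ : NonZero b}} → (u * w) % b ≡ 1 % b →
    ∀ {r} → r < b → (u * ((w * r) % b)) % b ≡ r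
  mod-inverse-cancel {u} {w} {b} uw≡1 {r} r<b = begin
    (u * ((w * r) % b)) % b       ≡⟨ m*[n%d]%d≡m*n%d u (w * r) b ⟩
    (u * (w * r)) % b             ≡⟨ %-congˡ (ℕ.*-assoc u w r) ⟨
    (u * w * r) % b               ≡⟨ %-distribˡ-* (u * w) r b ⟩
    ((u * w) % b * (r % b)) % b   ≡⟨ ≡.cong (λ z → (z * (r % b)) % b) uw≡1 ⟩
    ((1 % b) * (r % b)) % b       ≡⟨ %-distribˡ-* 1 r b ⟨
    (1 * r) % b                   ≡⟨ %-congˡ (ℕ.*-identityˡ r) ⟩
    r % b                         ≡⟨ m<n⇒m%n≡m r<b ⟩
    r                             ∎

  *-mod-bijection : ∀ {k b} .{{_ : NonZero b}} → Coprime k b → Bijection (_< b) (_< b)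
  *-mod-bijection {k} {b} coprime = record
    { to = λ r → (k * r) % b
    ; from = λ s → (v * s) % b
    ; to-∈ = λ _ → m%n<n _ b
    ; from-∈ = λ _ → m%n<n _ b
    ; from∘to = mod-inverse-cancel {v} {k} vk≡1
    ; to∘from = mod-inverse-cancel {k} {v} (≡.trans (%-congˡ (ℕ.*-comm k v)) vk≡1)
    }
    where
    v : ℕ
    v = proj₁ (mod-inverse coprime)
    vk≡1 : (v * k) % b ≡ 1 % b
    vk≡1 = proj₂ (mod-inverse coprime)

open Residues using (*-mod-bijection)

m≡q*d⇒m/d≡q : ∀ {m d q} .{{_ : NonZero d}} → m ≡ q ℕ.* d → m / d ≡ q
m≡q*d⇒m/d≡q {d = d} {q} m≡qd = ≡.trans (/-congˡ m≡qd) (m*n/n≡m q d)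

nonZero-factorˡ : ∀ {m} p q .{{_ : NonZero m}} → m ≡ p ℕ.* q → NonZero p
nonZero-factorˡ p q ⦃ m≢0 ⦄ m≡pq = ℕ.m*n≢0⇒m≢0 p ⦃ ≡.subst NonZero m≡pq m≢0 ⦄

module GcdCofactors where
  open import Data.Nat using (_*_)
  open import Data.Nat.GCD using (gcd; gcd[m,n]∣m; gcd[m,n]∣n; gcd[m,n]≢0; c*gcd[m,n]≡gcd[cm,cn])
  open import Data.Nat.Coprimality using (coprime⇒gcd≡1; coprime-/gcd)
  open import Data.Nat.Divisibility using (divides; quotient; quotient≢0; n/m≡quotient; m∣n⇒n≡quotient*m)
  open import Data.Sum using (inj₂)
  open ≡.≡-Reasoning

  gcd-nonZeroʳ : ∀ k b .{{_ : NonZero b}} → NonZero (gcd k b)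
  gcd-nonZeroʳ k b = ℕ.≢-nonZero (gcd[m,n]≢0 k b (inj₂ (ℕ.≢-nonZero⁻¹ b)))

  gcd-cofactors : ∀ {k b c u v} → k ≡ u * c → b ≡ v * c → Coprime u v → gcd k b ≡ c
  gcd-cofactors {c = c} {u} {v} ≡.refl ≡.refl coprime = begin
    gcd (u * c) (v * c) ≡⟨ ≡.cong₂ gcd (ℕ.*-comm u c) (ℕ.*-comm v c) ⟩
    gcd (c * u) (c * v) ≡⟨ c*gcd[m,n]≡gcd[cm,cn] c u v ⟨
    c * gcd u v         ≡⟨ ≡.cong (c *_) (coprime⇒gcd≡1 coprime) ⟩
    c * 1               ≡⟨ ℕ.*-identityʳ c ⟩
    c                   ∎

  quotient-unique : ∀ {d k u} .{{_ : NonZero d}} (d∣k : d ∣ k) → k ≡ u * d → quotient d∣k ≡ u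
  quotient-unique {d} {u = u} (divides q k≡qd) k≡ud = ℕ.*-cancelʳ-≡ q u d (≡.trans (≡.sym k≡qd) k≡ud)

  module Cofactors (k b : ℕ) .{{_ : NonZero b}} where
    g k̂ b̂ : ℕ
    g = gcd k b
    k̂ = quotient (gcd[m,n]∣m k b)
    b̂ = quotient (gcd[m,n]∣n k b)

    g≢0 : NonZero g
    g≢0 = gcd-nonZeroʳ k b

    b̂≢0 : NonZero b̂
    b̂≢0 = quotient≢0 (gcd[m,n]∣n k b)

    k≡k̂g : k ≡ k̂ * g
    k≡k̂g = m∣n⇒n≡quotient*m (gcd[m,n]∣m k b)

    b≡b̂g : b ≡ b̂ * g
    b≡b̂g = m∣n⇒n≡quotient*m (gcd[m,n]∣n k b)

    coprime : Coprime k̂ b̂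
    coprime = ≡.subst₂ Coprime
      (n/m≡quotient (gcd[m,n]∣m k b) ⦃ g≢0 ⦄) (n/m≡quotient (gcd[m,n]∣n k b) ⦃ g≢0 ⦄) (coprime-/gcd k b ⦃ g≢0 ⦄)

module Fractions where
  open import Data.Nat using (_+_; _*_)
  open import Data.Rational as ℚ using (1ℚ; toℚᵘ)
  import Data.Rational.Properties as ℚ
  open import Data.Nat.Tactic.RingSolver using (solve-∀)
  open import Data.Rational.Unnormalised as ℚᵘ using (mkℚᵘ; *≡*)
  import Data.Rational.Unnormalised.Properties as ℚᵘ

  toℚᵘ-/ : ∀ p q .{{_ : NonZero q}} → toℚᵘ (+ p ℚ./ q) ℚᵘ.≃ mkℚᵘ (+ p) (pred q)
  toℚᵘ-/ p (suc q) = ℚ.toℚᵘ-fromℚᵘ (mkℚᵘ (+ p) q)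

  /-cross : ∀ p q p′ q′ .{{_ : NonZero q}} .{{_ : NonZero q′}} →
    p * q′ ≡ p′ * q → + p ℚ./ q ≡ + p′ ℚ./ q′
  /-cross p q@(suc _) p′ q′@(suc _) pq′≡p′q = ℚ.toℚᵘ-injective
    (ℚᵘ.≃-trans (toℚᵘ-/ p q) (ℚᵘ.≃-trans (*≡* cross) (ℚᵘ.≃-sym (toℚᵘ-/ p′ q′))))
    where
    cross : + p ℤ.* + q′ ≡ + p′ ℤ.* + q
    cross = ≡.trans (≡.sym (ℤ.pos-* p q′)) (≡.trans (≡.cong +_ pq′≡p′q) (ℤ.pos-* p′ q))

  /-+ : ∀ p q p′ q′ .{{_ : NonZero q}} .{{_ : NonZero q′}} .{{_ : NonZero (q * q′)}} →
    + p ℚ./ q ℚ.+ + p′ ℚ./ q′ ≡ + (p * q′ + p′ * q) ℚ./ (q * q′)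
  /-+ p q@(suc _) p′ q′@(suc _) = ℚ.toℚᵘ-injective
    (ℚᵘ.≃-trans (ℚ.toℚᵘ-homo-+ (+ p ℚ./ q) (+ p′ ℚ./ q′))
    (ℚᵘ.≃-trans (ℚᵘ.+-cong (toℚᵘ-/ p q) (toℚᵘ-/ p′ q′))
    (ℚᵘ.≃-trans (ℚᵘ.≃-reflexive (≡.cong (λ z → mkℚᵘ z _) numerator))
    (ℚᵘ.≃-sym (toℚᵘ-/ (p * q′ + p′ * q) (q * q′))))))
    where
    numerator : + p ℤ.* + q′ ℤ.+ + p′ ℤ.* + q ≡ + (p * q′ + p′ * q)
    numerator = ≡.sym (≡.trans (ℤ.pos-+ (p * q′) (p′ * q)) (≡.cong₂ ℤ._+_ (ℤ.pos-* p q′) (ℤ.pos-* p′ q)))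

  /-* : ∀ p q p′ q′ .{{_ : NonZero q}} .{{_ : NonZero q′}} .{{_ : NonZero (q * q′)}} →
    (+ p ℚ./ q) ℚ.* (+ p′ ℚ./ q′) ≡ + (p * p′) ℚ./ (q * q′)
  /-* p q@(suc _) p′ q′@(suc _) = ℚ.toℚᵘ-injective
    (ℚᵘ.≃-trans (ℚ.toℚᵘ-homo-* (+ p ℚ./ q) (+ p′ ℚ./ q′))
    (ℚᵘ.≃-trans (ℚᵘ.*-cong (toℚᵘ-/ p q) (toℚᵘ-/ p′ q′))
    (ℚᵘ.≃-trans (ℚᵘ.≃-reflexive (≡.cong (λ z → mkℚᵘ z _) (≡.sym (ℤ.pos-* p p′))))
    (ℚᵘ.≃-sym (toℚᵘ-/ (p * p′) (q * q′))))))


  p/q+1≡[q+p]/q : ∀ p q .{{_ : NonZero q}} → + p ℚ./ q ℚ.+ 1ℚ ≡ + (q + p) ℚ./ q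
  p/q+1≡[q+p]/q p q = ≡.trans (/-+ p q 1 1) (/-cross (p * 1 + 1 * q) (q * 1) (q + p) q (identity p q))
    where
    instance
      q*1≢0 : NonZero (q * 1)
      q*1≢0 = m*n≢0 q 1
    identity : ∀ p q → (p * 1 + 1 * q) * q ≡ (q + p) * (q * 1)
    identity = solve-∀

  p/qc+s/c≡[p+sq]/qc : ∀ p q c s .{{_ : NonZero c}} .{{_ : NonZero (q * c)}} →
    + p ℚ./ (q * c) ℚ.+ + s ℚ./ c ≡ + (p + s * q) ℚ./ (q * c)
  p/qc+s/c≡[p+sq]/qc p q c s = ≡.trans (/-+ p (q * c) s c)
    (/-cross (p * c + s * (q * c)) (q * c * c) (p + s * q) (q * c) (identity p q c s))
    where
    instance
      qc*c≢0 : NonZero (q * c * c)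
      qc*c≢0 = m*n≢0 (q * c) c
    identity : ∀ p q c s → (p * c + s * (q * c)) * (q * c) ≡ (p + s * q) * (q * c * c)
    identity = solve-∀

  c/1*p/qc≡p/q : ∀ c p q .{{_ : NonZero q}} .{{_ : NonZero (q * c)}} →
    (+ c ℚ./ 1) ℚ.* (+ p ℚ./ (q * c)) ≡ + p ℚ./ q
  c/1*p/qc≡p/q c p q = ≡.trans (/-* c 1 p (q * c)) (/-cross (c * p) (1 * (q * c)) p q (identity c p q))
    where
    instance
      1*qc≢0 : NonZero (1 * (q * c))
      1*qc≢0 = m*n≢0 1 (q * c)
    identity : ∀ c p q → c * p * q ≡ p * (1 * (q * c))
    identity = solve-∀

module Sums {c ℓ} (R : ℚAlgebra c ℓ) where
  open ℚAlgebra R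
  open import Relation.Binary.Reasoning.Setoid setoid
  open import Algebra.Properties.CommutativeSemigroup +-commutativeSemigroup
    using () renaming (interchange to +-interchange)

  sumTo-cong : ∀ N {f g} → (∀ {i} → i < N → f i ≈ g i) → sumTo N f ≈ sumTo N g
  sumTo-cong zero f≈g = refl
  sumTo-cong (suc N) f≈g = +-cong (sumTo-cong N (f≈g ∘ ℕ.m<n⇒m<1+n)) (f≈g (ℕ.n<1+n N))

  sumTo-zero : ∀ N {f} → (∀ {i} → i < N → f i ≈ 0#) → sumTo N f ≈ 0#
  sumTo-zero zero f≈0 = refl
  sumTo-zero (suc N) f≈0 =
    trans (+-cong (sumTo-zero N (f≈0 ∘ ℕ.m<n⇒m<1+n)) (f≈0 (ℕ.n<1+n N))) (+-identityʳ 0#)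

  sumTo-distrib-+ : ∀ N (f g : ℕ → Carrier) →
    sumTo N (λ i → f i + g i) ≈ sumTo N f + sumTo N g
  sumTo-distrib-+ zero f g = sym (+-identityʳ 0#)
  sumTo-distrib-+ (suc N) f g = trans (+-cong (sumTo-distrib-+ N f g) refl) (+-interchange _ _ _ _)

  sumTo-distribˡ : ∀ N x (f : ℕ → Carrier) → x * sumTo N f ≈ sumTo N (λ i → x * f i)
  sumTo-distribˡ zero x f = zeroʳ x
  sumTo-distribˡ (suc N) x f = trans (distribˡ x _ _) (+-cong (sumTo-distribˡ N x f) refl)

  sumTo-distribʳ : ∀ N x (f : ℕ → Carrier) → sumTo N f * x ≈ sumTo N (λ i → f i * x)
  sumTo-distribʳ zero x f = zeroˡ x
  sumTo-distribʳ (suc N) x f = trans (distribʳ x _ _) (+-cong (sumTo-distribʳ N x f) refl)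

  sumTo-comm : ∀ N M (F : ℕ → ℕ → Carrier) →
    sumTo N (λ i → sumTo M (F i)) ≈ sumTo M (λ j → sumTo N (λ i → F i j))
  sumTo-comm zero M F = sym (sumTo-zero M (λ _ → refl))
  sumTo-comm (suc N) M F =
    trans (+-cong (sumTo-comm N M F) refl) (sym (sumTo-distrib-+ M _ (F N)))

  sumTo-split : ∀ L K (f : ℕ → Carrier) →
    sumTo (L ℕ.+ K) f ≈ sumTo L f + sumTo K (λ i → f (L ℕ.+ i))
  sumTo-split L zero f = begin
    sumTo (L ℕ.+ 0) f ≡⟨ ≡.cong (λ N → sumTo N f) (ℕ.+-identityʳ L) ⟩
    sumTo L f         ≈⟨ +-identityʳ _ ⟨
    sumTo L f + 0#    ∎
  sumTo-split L (suc K) f = begin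
    sumTo (L ℕ.+ suc K) f                                   ≡⟨ ≡.cong (λ N → sumTo N f) (ℕ.+-suc L K) ⟩
    sumTo (L ℕ.+ K) f + f (L ℕ.+ K)                         ≈⟨ +-cong (sumTo-split L K f) refl ⟩
    (sumTo L f + sumTo K (λ i → f (L ℕ.+ i))) + f (L ℕ.+ K) ≈⟨ +-assoc _ _ _ ⟩
    sumTo L f + sumTo (suc K) (λ i → f (L ℕ.+ i))           ∎

  if-yes : ∀ {A : Set} (a? : Dec A) {x y : Carrier} → A → (if does a? then x else y) ≈ x
  if-yes a? {x} {y} a = reflexive (≡.cong (λ b → if b then x else y) (dec-true a? a))

  if-no : ∀ {A : Set} (a? : Dec A) {x y : Carrier} → ¬ A → (if does a? then x else y) ≈ y
  if-no a? {x} {y} ¬a = reflexive (≡.cong (λ b → if b then x else y) (dec-false a? ¬a))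

  if-does-cong : ∀ {A : Set} (a? : Dec A) (h : Carrier → Carrier) {x y} → h 0# ≈ 0# → (A → h x ≈ y) →
    h (if does a? then x else 0#) ≈ (if does a? then y else 0#)
  if-does-cong (yes a) h _ hx≈y = hx≈y a
  if-does-cong (no _) h h0≈0 _ = h0≈0

  sumTo-unique : ∀ {P : Pred ℕ 0ℓ} (P? : Decidable P) N {a} (G : ℕ → Carrier) →
    a < N → P a → (∀ {i} → i < N → P i → i ≡ a) →
    sumTo N (λ i → if does (P? i) then G i else 0#) ≈ G a
  sumTo-unique P? (suc N) {a} G a<1+N Pa unique with a ℕ.≟ N
  ... | yes ≡.refl = begin
    sumTo N (λ i → if does (P? i) then G i else 0#) + (if does (P? N) then G N else 0#)
      ≈⟨ +-cong (sumTo-zero N (λ i<N → if-no (P? _) (λ Pi → ℕ.<-irrefl (unique (ℕ.m<n⇒m<1+n i<N) Pi) i<N)))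
                (if-yes (P? N) Pa) ⟩
    0# + G N ≈⟨ +-identityˡ _ ⟩
    G N      ∎
  ... | no a≢N = begin
    sumTo N (λ i → if does (P? i) then G i else 0#) + (if does (P? N) then G N else 0#)
      ≈⟨ +-cong (sumTo-unique P? N G (ℕ.≤∧≢⇒< (ℕ.≤-pred a<1+N) a≢N) Pa (unique ∘ ℕ.m<n⇒m<1+n))
                (if-no (P? N) (λ PN → a≢N (≡.sym (unique (ℕ.n<1+n N) PN)))) ⟩
    G a + 0# ≈⟨ +-identityʳ _ ⟩
    G a      ∎

  sumTo-truncate : ∀ {L K} (f : ℕ → Carrier) → L ≤ K →
    sumTo K (λ i → if does (i <? L) then f i else 0#) ≈ sumTo L f
  sumTo-truncate {L} {K} f L≤K = begin
    sumTo K f<L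
      ≡⟨ ≡.cong (λ N → sumTo N f<L) (ℕ.m+[n∸m]≡n L≤K) ⟨
    sumTo (L ℕ.+ (K ℕ.∸ L)) f<L
      ≈⟨ sumTo-split L (K ℕ.∸ L) f<L ⟩
    sumTo L f<L + sumTo (K ℕ.∸ L) (λ i → f<L (L ℕ.+ i))
      ≈⟨ +-cong (sumTo-cong L (if-yes (_ <? L))) (sumTo-zero (K ℕ.∸ L) (λ _ → if-no (_ <? L) (ℕ.m+n≮m L _))) ⟩
    sumTo L f + 0#
      ≈⟨ +-identityʳ _ ⟩
    sumTo L f ∎
    where
    f<L : ℕ → Carrier
    f<L i = if does (i <? L) then f i else 0#

  -- Guards use does rather than ⌊_⌋ (as in Defs): does (p ×-dec q) computes to does p ∧ does q.
  sumDivisors≈sumTo : ∀ N (g : (b : ℕ) → .{{NonZero b}} → Carrier) {G : ℕ → Carrier} →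
    (∀ x → g (suc x) ≈ G x) → sumDivisors N g ≈ sumTo N (λ x → if does (suc x ∣? N) then G x else 0#)
  sumDivisors≈sumTo N g g≈G = sumTo-cong N λ {x} _ →
    trans (reflexive (≡.cong (λ b → if b then g (suc x) else 0#) (isYes≗does (suc x ∣? N))))
          (if-does-cong (suc x ∣? N) (λ z → z) refl (λ _ → g≈G x))

  record Periodic (L : ℕ) (h : ℕ → Carrier) : Set ℓ where
    field shift : ∀ i → h (L ℕ.+ i) ≈ h i

  open Periodic public

  sumTo-periodic : ∀ K {L h} → Periodic L h → sumTo (K ℕ.* L) h ≈ fromℕ K * sumTo L h
  sumTo-periodic zero _ = sym (zeroˡ _)
  sumTo-periodic (suc K) {L} {h} h-per = begin
    sumTo (L ℕ.+ K ℕ.* L) h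
      ≈⟨ sumTo-split L (K ℕ.* L) h ⟩
    sumTo L h + sumTo (K ℕ.* L) (λ i → h (L ℕ.+ i))
      ≈⟨ +-cong refl (sumTo-cong (K ℕ.* L) (λ {i} _ → shift h-per i)) ⟩
    sumTo L h + sumTo (K ℕ.* L) h
      ≈⟨ +-cong (*-identityˡ _) (sym (sumTo-periodic K h-per)) ⟨
    1# * sumTo L h + fromℕ K * sumTo L h
      ≈⟨ distribʳ _ _ _ ⟨
    (1# + fromℕ K) * sumTo L h ∎

  periodic-multiple : ∀ {L h} → Periodic L h → ∀ i t → h (i ℕ.+ t ℕ.* L) ≈ h i
  periodic-multiple {h = h} _ i zero = reflexive (≡.cong h (ℕ.+-identityʳ i))
  periodic-multiple {L} {h} h-per i (suc t) = begin
    h (i ℕ.+ (L ℕ.+ t ℕ.* L)) ≡⟨ ≡.cong h (≡.trans (ℕ.+-comm i _) (ℕ.+-assoc L _ i)) ⟩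
    h (L ℕ.+ (t ℕ.* L ℕ.+ i)) ≈⟨ shift h-per _ ⟩
    h (t ℕ.* L ℕ.+ i)         ≡⟨ ≡.cong h (ℕ.+-comm _ i) ⟩
    h (i ℕ.+ t ℕ.* L)         ≈⟨ periodic-multiple h-per i t ⟩
    h i                       ∎

  periodic-mod : ∀ {L h} → .{{_ : NonZero L}} → Periodic L h → ∀ i → h i ≈ h (i % L)
  periodic-mod {L} {h} h-per i = begin
    h i                         ≡⟨ ≡.cong h (m≡m%n+[m/n]*n i L) ⟩
    h (i % L ℕ.+ (i / L) ℕ.* L) ≈⟨ periodic-multiple h-per (i % L) (i / L) ⟩
    h (i % L)                   ∎

module PairSums {c ℓ} (R : ℚAlgebra c ℓ) where
  open ℚAlgebra R
  open import Relation.Binary.Reasoning.Setoid setoid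
  open Sums R

  sum² : ℕ → ℕ → (ℕ × ℕ → Carrier) → Carrier
  sum² N M h = sumTo N (λ x → sumTo M (λ y → h (x , y)))

  sum²-cong : ∀ N M {f g} → (∀ {i} → InBox N M i → f i ≈ g i) → sum² N M f ≈ sum² N M g
  sum²-cong N M f≈g = sumTo-cong N (λ x<N → sumTo-cong M (λ y<M → f≈g (x<N , y<M)))

  sum²-zero : ∀ N M {f} → (∀ {i} → InBox N M i → f i ≈ 0#) → sum² N M f ≈ 0#
  sum²-zero N M f≈0 = sumTo-zero N (λ x<N → sumTo-zero M (λ y<M → f≈0 (x<N , y<M)))

  sum²-comm : ∀ N₁ N₂ M₁ M₂ (F : ℕ × ℕ → ℕ × ℕ → Carrier) →
    sum² N₁ N₂ (λ i → sum² M₁ M₂ (F i)) ≈ sum² M₁ M₂ (λ j → sum² N₁ N₂ (λ i → F i j))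
  sum²-comm N₁ N₂ M₁ M₂ F =
    trans (sumTo-cong N₁ (λ _ → trans (sumTo-comm N₂ M₁ _) (sumTo-cong M₁ (λ _ → sumTo-comm N₂ M₂ _))))
          (trans (sumTo-comm N₁ M₁ _) (sumTo-cong M₁ (λ _ → sumTo-comm N₁ M₂ _)))

  sum²-unique : ∀ {P : Pred (ℕ × ℕ) 0ℓ} (P? : Decidable P) N M {a} (G : ℕ × ℕ → Carrier) →
    InBox N M a → P a → (∀ {i} → InBox N M i → P i → i ≡ a) →
    sum² N M (λ i → if does (P? i) then G i else 0#) ≈ G a
  sum²-unique P? N M {a₁ , a₂} G (a₁<N , a₂<M) Pa unique =
    trans (sumTo-cong N fibre)
          (sumTo-unique (ℕ._≟ a₁) N (λ _ → G (a₁ , a₂)) a₁<N ≡.refl (λ _ x≡a₁ → x≡a₁))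
    where
    fibre : ∀ {x} → x < N →
      sumTo M (λ y → if does (P? (x , y)) then G (x , y) else 0#) ≈ (if does (x ℕ.≟ a₁) then G (a₁ , a₂) else 0#)
    fibre {x} x<N with x ℕ.≟ a₁
    ... | yes ≡.refl = trans
      (sumTo-unique (λ y → P? (x , y)) M (λ y → G (x , y)) a₂<M Pa
        (λ y<M P → ≡.cong proj₂ (unique (x<N , y<M) P)))
      (sym (if-yes (x ℕ.≟ x) ≡.refl))
    ... | no x≢a₁ = trans
      (sumTo-zero M (λ y<M → if-no (P? _) (λ P → x≢a₁ (≡.cong proj₁ (unique (x<N , y<M) P)))))
      (sym (if-no (x ℕ.≟ a₁) x≢a₁))

  -- Both sides are the sum of H j over the pairs (i , j) with P i and to i ≡ j.
  sum²-reindex : ∀ {N₁ N₂ M₁ M₂} {P Q : Pred (ℕ × ℕ) 0ℓ} (P? : Decidable P) (Q? : Decidable Q)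
    (β : Bijection (InBox N₁ N₂ ∩ P) (InBox M₁ M₂ ∩ Q)) (H : ℕ × ℕ → Carrier) →
    sum² N₁ N₂ (λ i → if does (P? i) then H (Bijection.to β i) else 0#) ≈
    sum² M₁ M₂ (λ j → if does (Q? j) then H j else 0#)
  sum²-reindex {N₁} {N₂} {M₁} {M₂} {P} P? Q? β H = begin
    sum² N₁ N₂ (λ i → if does (P? i) then H (to i) else 0#) ≈⟨ sum²-cong N₁ N₂ row ⟨
    sum² N₁ N₂ (λ i → sum² M₁ M₂ (K i))                 ≈⟨ sum²-comm N₁ N₂ M₁ M₂ K ⟩
    sum² M₁ M₂ (λ j → sum² N₁ N₂ (λ i → K i j))          ≈⟨ sum²-cong M₁ M₂ column ⟩
    sum² M₁ M₂ (λ j → if does (Q? j) then H j else 0#)      ∎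
    where
    open Bijection β
    K : ℕ × ℕ → ℕ × ℕ → Carrier
    K i j = if does (P? i ×-dec to i ≟² j) then H j else 0#
    row : ∀ {i} → InBox N₁ N₂ i → sum² M₁ M₂ (K i) ≈ (if does (P? i) then H (to i) else 0#)
    row {i} i∈ with P? i
    ... | yes p = sum²-unique (to i ≟²_) M₁ M₂ H (proj₁ (to-∈ (i∈ , p))) ≡.refl (λ _ → ≡.sym)
    ... | no _ = sum²-zero M₁ M₂ (λ _ → refl)
    column : ∀ {j} → InBox M₁ M₂ j → sum² N₁ N₂ (λ i → K i j) ≈ (if does (Q? j) then H j else 0#)
    column {j} j∈ with Q? j
    ... | yes q = sum²-unique (λ i → P? i ×-dec to i ≟² j) N₁ N₂ (λ _ → H j)
                    (proj₁ (from-∈ (j∈ , q))) (proj₂ (from-∈ (j∈ , q)) , to∘from (j∈ , q)) unique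
      where
      unique : ∀ {i} → InBox N₁ N₂ i → P i × to i ≡ j → i ≡ from j
      unique i∈ (p , ≡.refl) = ≡.sym (from∘to (i∈ , p))
    ... | no ¬q = sum²-zero N₁ N₂ (λ {i} i∈ →
      if-no (P? i ×-dec to i ≟² j) (λ { (p , ≡.refl) → ¬q (proj₂ (to-∈ (i∈ , p))) }))

  sumTo-permute : ∀ N (β : Bijection (_< N) (_< N)) (h : ℕ → Carrier) →
    sumTo N (h ∘ Bijection.to β) ≈ sumTo N h
  sumTo-permute N β h = begin
    sumTo N (h ∘ to)                                         ≈⟨ +-identityˡ _ ⟨
    sum² 1 N (λ i → if does (U? i) then h (proj₂ (to² i)) else 0#) ≈⟨ sum²-reindex U? U? β² (h ∘ proj₂) ⟩
    sum² 1 N (λ j → if does (U? j) then h (proj₂ j) else 0#)       ≈⟨ +-identityˡ _ ⟩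
    sumTo N h                                                ∎
    where
    open Bijection β
    to² : ℕ × ℕ → ℕ × ℕ
    to² (x , r) = x , to r
    β² : Bijection (InBox 1 N ∩ U) (InBox 1 N ∩ U)
    β² = record
      { to = to²
      ; from = λ (x , r) → x , from r
      ; to-∈ = λ ((x<1 , r<N) , _) → (x<1 , to-∈ r<N) , _
      ; from-∈ = λ ((x<1 , r<N) , _) → (x<1 , from-∈ r<N) , _
      ; from∘to = λ ((_ , r<N) , _) → ≡.cong (_ ,_) (from∘to r<N)
      ; to∘from = λ ((_ , r<N) , _) → ≡.cong (_ ,_) (to∘from r<N)
      }

  sumTo-dilate : ∀ g {k b} .{{_ : NonZero b}} {h} → Coprime k b → Periodic b h →
    sumTo (g ℕ.* b) (λ r → h (k ℕ.* r)) ≈ fromℕ g * sumTo b h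
  sumTo-dilate g {k} {b} {h} coprime h-per = begin
    sumTo (g ℕ.* b) (λ r → h (k ℕ.* r))         ≈⟨ sumTo-periodic g dilate-periodic ⟩
    fromℕ g * sumTo b (λ r → h (k ℕ.* r))       ≈⟨ *-cong refl (sumTo-cong b (λ _ → periodic-mod h-per _)) ⟩
    fromℕ g * sumTo b (λ r → h ((k ℕ.* r) % b)) ≈⟨ *-cong refl (sumTo-permute b (*-mod-bijection coprime) h) ⟩
    fromℕ g * sumTo b h                         ∎
    where
    dilate-periodic : Periodic b (λ r → h (k ℕ.* r))
    dilate-periodic .shift r = begin
      h (k ℕ.* (b ℕ.+ r))     ≡⟨ ≡.cong h (≡.trans (ℕ.*-distribˡ-+ k b r) (ℕ.+-comm (k ℕ.* b) _)) ⟩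
      h (k ℕ.* r ℕ.+ k ℕ.* b) ≈⟨ periodic-multiple h-per (k ℕ.* r) k ⟩
      h (k ℕ.* r)             ∎

  sumTo-dependent≈sum² : ∀ {D : Pred ℕ 0ℓ} (D? : Decidable D) N M (L : ℕ → ℕ) (G : ℕ → ℕ → Carrier) →
    (∀ {x} → D x → L x ≤ M) →
    sumTo N (λ x → if does (D? x) then sumTo (L x) (G x) else 0#) ≈
    sum² N M (λ (x , k) → if does (D? x ×-dec k <? L x) then G x k else 0#)
  sumTo-dependent≈sum² D? N M L G L≤M = sumTo-cong N fibre
    where
    fibre : ∀ {x} → x < N → (if does (D? x) then sumTo (L x) (G x) else 0#) ≈
                            sumTo M (λ k → if does (D? x ×-dec k <? L x) then G x k else 0#)
    fibre {x} _ with D? x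
    ... | yes Dx = sym (sumTo-truncate (G x) (L≤M Dx))
    ... | no _ = sym (sumTo-zero M (λ _ → refl))

module Products {c ℓ} (R : ℚAlgebra c ℓ) where
  open ℚAlgebra R
  open import Relation.Binary.Reasoning.Setoid setoid
  open import Algebra.Properties.CommutativeSemigroup *-commutativeSemigroup
    using () renaming (interchange to *-interchange)
  open Sums R

  prodFin-cong : ∀ d {f g : Fin d → Carrier} → (∀ j → f j ≈ g j) → prodFin d f ≈ prodFin d g
  prodFin-cong zero f≈g = refl
  prodFin-cong (suc d) f≈g = *-cong (f≈g zero) (prodFin-cong d (f≈g ∘ suc))

  prodFin-distrib-* : ∀ d (f g : Fin d → Carrier) →
    prodFin d (λ j → f j * g j) ≈ prodFin d f * prodFin d g
  prodFin-distrib-* zero f g = sym (*-identityˡ 1#)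
  prodFin-distrib-* (suc d) f g = trans (*-cong refl (prodFin-distrib-* d _ _)) (*-interchange _ _ _ _)

  prodFin-const : ∀ d x → prodFin d (λ _ → x) ≈ pow x d
  prodFin-const zero x = refl
  prodFin-const (suc d) x = *-cong refl (prodFin-const d x)

  sumTuples-distribˡ : ∀ d b x (g : (Fin d → ℕ) → Carrier) →
    x * sumTuples d b g ≈ sumTuples d b (λ r → x * g r)
  sumTuples-distribˡ zero b x g = refl
  sumTuples-distribˡ (suc d) b x g =
    trans (sumTo-distribˡ b x _) (sumTo-cong b (λ _ → sumTuples-distribˡ d b x _))

  sumTuples-comm : ∀ d b N (F : (Fin d → ℕ) → ℕ → Carrier) →
    sumTuples d b (λ r → sumTo N (F r)) ≈ sumTo N (λ k → sumTuples d b (λ r → F r k))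
  sumTuples-comm zero b N F = refl
  sumTuples-comm (suc d) b N F = trans (sumTo-cong b (λ _ → sumTuples-comm d b N _)) (sumTo-comm b N _)

  sumTuples-prodFin : ∀ d b (h : Fin d → ℕ → Carrier) →
    sumTuples d b (λ r → prodFin d (λ j → h j (r j))) ≈ prodFin d (λ j → sumTo b (h j))
  sumTuples-prodFin zero b h = refl
  sumTuples-prodFin (suc d) b h = begin
    sumTo b (λ r₀ → sumTuples d b (λ r → h zero r₀ * prodFin d (λ j → h (suc j) (r j))))
      ≈⟨ sumTo-cong b (λ _ → sumTuples-distribˡ d b _ _) ⟨
    sumTo b (λ r₀ → h zero r₀ * sumTuples d b (λ r → prodFin d (λ j → h (suc j) (r j))))
      ≈⟨ sumTo-cong b (λ _ → *-cong refl (sumTuples-prodFin d b (h ∘ suc))) ⟩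
    sumTo b (λ r₀ → h zero r₀ * prodFin d (λ j → sumTo b (h (suc j))))
      ≈⟨ sumTo-distribʳ b _ _ ⟨
    sumTo b (h zero) * prodFin d (λ j → sumTo b (h (suc j))) ∎

module Powers {c ℓ} (R : ℚAlgebra c ℓ) where
  open ℚAlgebra R
  open import Relation.Binary.Reasoning.Setoid setoid
  open import Algebra.Properties.CommutativeSemigroup *-commutativeSemigroup
    using () renaming (interchange to *-interchange)
  open import Algebra.Properties.Semiring.Mult semiring using (×1-homo-*) renaming (_×_ to _·_)
  open Products R using (prodFin-cong)

  pow-cong : ∀ n {x y} → x ≈ y → pow x n ≈ pow y n
  pow-cong zero x≈y = refl
  pow-cong (suc n) x≈y = *-cong x≈y (pow-cong n x≈y)

  pow-homo-* : ∀ x m n → pow x (m ℕ.+ n) ≈ pow x m * pow x n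
  pow-homo-* x zero n = sym (*-identityˡ _)
  pow-homo-* x (suc m) n = trans (*-cong refl (pow-homo-* x m n)) (sym (*-assoc _ _ _))

  pow-distrib-* : ∀ x y n → pow (x * y) n ≈ pow x n * pow y n
  pow-distrib-* x y zero = sym (*-identityˡ 1#)
  pow-distrib-* x y (suc n) = trans (*-cong refl (pow-distrib-* x y n)) (*-interchange _ _ _ _)

  fromℕ≡n·1# : ∀ n → fromℕ n ≡ n · 1#
  fromℕ≡n·1# zero = ≡.refl
  fromℕ≡n·1# (suc n) = ≡.cong (λ x → 1# + x) (fromℕ≡n·1# n)

  fromℕ-homo-* : ∀ m n → fromℕ (m ℕ.* n) ≈ fromℕ m * fromℕ n
  fromℕ-homo-* m n rewrite fromℕ≡n·1# (m ℕ.* n) | fromℕ≡n·1# m | fromℕ≡n·1# n = ×1-homo-* m n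

  inv-inverseʳ : ∀ b .{{_ : NonZero b}} → fromℕ b * inv b ≈ 1#
  inv-inverseʳ (suc b) = inv-law b

  inverse-unique : ∀ {x u v} → x * u ≈ 1# → x * v ≈ 1# → u ≈ v
  inverse-unique {x} {u} {v} xu≈1 xv≈1 = begin
    u           ≈⟨ *-identityʳ u ⟨
    u * 1#      ≈⟨ *-cong refl xv≈1 ⟨
    u * (x * v) ≈⟨ *-assoc u x v ⟨
    (u * x) * v ≈⟨ *-cong (trans (*-comm u x) xu≈1) refl ⟩
    1# * v      ≈⟨ *-identityˡ v ⟩
    v           ∎

  inv-distrib-* : ∀ b b′ .{{_ : NonZero b}} .{{_ : NonZero b′}} →
    inv (b ℕ.* b′) ≈ inv b * inv b′
  inv-distrib-* b b′ = inverse-unique (inv-inverseʳ (b ℕ.* b′) {{m*n≢0 b b′}}) (begin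
    fromℕ (b ℕ.* b′) * (inv b * inv b′)     ≈⟨ *-cong (fromℕ-homo-* b b′) refl ⟩
    (fromℕ b * fromℕ b′) * (inv b * inv b′) ≈⟨ *-interchange _ _ _ _ ⟩
    (fromℕ b * inv b) * (fromℕ b′ * inv b′) ≈⟨ *-cong (inv-inverseʳ b) (inv-inverseʳ b′) ⟩
    1# * 1#                                 ≈⟨ *-identityˡ 1# ⟩
    1#                                      ∎)

  ipow-⊖ : ∀ b .{{_ : NonZero b}} p q → ipow b (p ⊖ q) ≈ pow (fromℕ b) p * pow (inv b) q
  ipow-⊖ b p zero = sym (*-identityʳ _)
  ipow-⊖ b zero (suc q) = sym (*-identityˡ _)
  ipow-⊖ b (suc p) (suc q) = begin
    ipow b (suc p ⊖ suc q)                             ≡⟨ ≡.cong (ipow b) (ℤ.[1+m]⊖[1+n]≡m⊖n p q) ⟩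
    ipow b (p ⊖ q)                                     ≈⟨ ipow-⊖ b p q ⟩
    pow (fromℕ b) p * pow (inv b) q                    ≈⟨ *-identityˡ _ ⟨
    1# * (pow (fromℕ b) p * pow (inv b) q)             ≈⟨ *-cong (inv-inverseʳ b) refl ⟨
    (fromℕ b * inv b) * (pow (fromℕ b) p * pow (inv b) q) ≈⟨ *-interchange _ _ _ _ ⟩
    pow (fromℕ b) (suc p) * pow (inv b) (suc q)        ∎

  ipow-homo-* : ∀ b .{{_ : NonZero b}} i j → ipow b (i ℤ.+ j) ≈ ipow b i * ipow b j
  ipow-homo-* b (+ p) (+ q) = pow-homo-* (fromℕ b) p q
  ipow-homo-* b (+ p) -[1+ q ] = ipow-⊖ b p (suc q)
  ipow-homo-* b -[1+ p ] (+ q) = trans (ipow-⊖ b q (suc p)) (*-comm _ _)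
  ipow-homo-* b -[1+ p ] -[1+ q ] =
    trans (reflexive (≡.cong (pow (inv b) ∘ suc) (≡.sym (ℕ.+-suc p q)))) (pow-homo-* (inv b) (suc p) (suc q))

  ipow-distrib-* : ∀ b b′ .{{_ : NonZero b}} .{{_ : NonZero b′}} z →
    ipow (b ℕ.* b′) z ≈ ipow b z * ipow b′ z
  ipow-distrib-* b b′ (+ k) = trans (pow-cong k (fromℕ-homo-* b b′)) (pow-distrib-* _ _ k)
  ipow-distrib-* b b′ -[1+ k ] = trans (pow-cong (suc k) (inv-distrib-* b b′)) (pow-distrib-* _ _ (suc k))

  ipow-1+ : ∀ b .{{_ : NonZero b}} z → fromℕ b * ipow b z ≈ ipow b (+ 1 ℤ.+ z)
  ipow-1+ b z = trans (*-cong (sym (*-identityʳ _)) refl) (sym (ipow-homo-* b (+ 1) z))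

  ipow-cancel-cofactor : ∀ {b} g b′ .{{_ : NonZero g}} .{{_ : NonZero b′}} → b ≡ g ℕ.* b′ → ∀ d z →
    ipow b (ℤ.- z) * (pow (fromℕ g) d * ipow b′ z) ≈ ipow g (+ d ℤ.- z)
  ipow-cancel-cofactor g b′ ≡.refl d z = begin
    ipow (g ℕ.* b′) (ℤ.- z) * (ipow g (+ d) * ipow b′ z)
      ≈⟨ *-cong (ipow-distrib-* g b′ (ℤ.- z)) refl ⟩
    (ipow g (ℤ.- z) * ipow b′ (ℤ.- z)) * (ipow g (+ d) * ipow b′ z)
      ≈⟨ *-interchange _ _ _ _ ⟩
    (ipow g (ℤ.- z) * ipow g (+ d)) * (ipow b′ (ℤ.- z) * ipow b′ z)
      ≈⟨ *-cong (*-comm _ _) refl ⟩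
    (ipow g (+ d) * ipow g (ℤ.- z)) * (ipow b′ (ℤ.- z) * ipow b′ z)
      ≈⟨ *-cong (ipow-homo-* g (+ d) (ℤ.- z)) (ipow-homo-* b′ (ℤ.- z) z) ⟨
    ipow g (+ d ℤ.- z) * ipow b′ (ℤ.- z ℤ.+ z)
      ≡⟨ ≡.cong (λ e → ipow g (+ d ℤ.- z) * ipow b′ e) (ℤ.+-inverseˡ z) ⟩
    ipow g (+ d ℤ.- z) * 1#
      ≈⟨ *-identityʳ _ ⟩
    ipow g (+ d ℤ.- z) ∎

  prodFin-ipow : ∀ d b .{{_ : NonZero b}} (m : Fin d → ℤ) →
    prodFin d (λ j → ipow b (m j)) ≈ ipow b (sumℤ d m)
  prodFin-ipow zero b m = refl
  prodFin-ipow (suc d) b m =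
    trans (*-cong refl (prodFin-ipow d b (m ∘ suc))) (sym (ipow-homo-* b (m zero) (sumℤ d (m ∘ suc))))

module DedekindTypeFunctions {c ℓ} (R : ℚAlgebra c ℓ) where
  open ℚAlgebra R
  open import Relation.Binary.Reasoning.Setoid setoid
  open import Data.Nat.Tactic.RingSolver using (solve-∀)
  open import Data.Rational as ℚ using (1ℚ)
  open Fractions
  open Sums R
  open PairSums R using (sumTo-dilate)

  _⟨_/_⟩ : (ℚ → Carrier) → ℕ → (q : ℕ) → .{{NonZero q}} → Carrier
  f ⟨ p / q ⟩ = f (+ p ℚ./ q)

  ⟨⟩-cross : ∀ f p q p′ q′ .{{_ : NonZero q}} .{{_ : NonZero q′}} →
    p ℕ.* q′ ≡ p′ ℕ.* q → f ⟨ p / q ⟩ ≈ f ⟨ p′ / q′ ⟩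
  ⟨⟩-cross f p q p′ q′ pq′≡p′q = reflexive (≡.cong f (/-cross p q p′ q′ pq′≡p′q))

  module _ {f : ℚ → Carrier} {m : ℤ} (f-dt : DedekindTypeFun f m) where

    ⟨⟩-periodic : ∀ q .{{_ : NonZero q}} → Periodic q (λ p → f ⟨ p / q ⟩)
    ⟨⟩-periodic q .shift p = begin
      f ⟨ q ℕ.+ p / q ⟩    ≡⟨ ≡.cong f (p/q+1≡[q+p]/q p q) ⟨
      f (+ p ℚ./ q ℚ.+ 1ℚ) ≈⟨ proj₁ f-dt _ ⟩
      f ⟨ p / q ⟩          ∎

    ⟨⟩-distribution : ∀ p q c .{{_ : NonZero q}} .{{_ : NonZero c}} .{{_ : NonZero (q ℕ.* c)}} →
      sumTo c (λ s → f ⟨ p ℕ.+ s ℕ.* q / q ℕ.* c ⟩) ≈ ipow c m * f ⟨ p / q ⟩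
    ⟨⟩-distribution p q c = begin
      sumTo c (λ s → f ⟨ p ℕ.+ s ℕ.* q / q ℕ.* c ⟩)
        ≈⟨ sumTo-cong c (λ {s} _ → reflexive (≡.cong f (p/qc+s/c≡[p+sq]/qc p q c s))) ⟨
      sumTo c (λ s → f (x ℚ.+ + s ℚ./ c))
        ≈⟨ proj₂ f-dt c x ⟩
      ipow c m * f ((+ c ℚ./ 1) ℚ.* x)
        ≡⟨ ≡.cong (λ y → ipow c m * f y) (c/1*p/qc≡p/q c p q) ⟩
      ipow c m * f ⟨ p / q ⟩ ∎
      where
      x : ℚ
      x = + p ℚ./ (q ℕ.* c)

    ⟨⟩-twisted-sum : ∀ A {a b g b′ k k′} .{{_ : NonZero a}} .{{_ : NonZero b′}} .{{_ : NonZero (a ℕ.* b)}} →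
      b ≡ b′ ℕ.* g → k ≡ k′ ℕ.* g → Coprime k′ b′ →
      sumTo b (λ r → f ⟨ k ℕ.* (A ℕ.+ r ℕ.* a) / a ℕ.* b ⟩) ≈ fromℕ g * (ipow b′ m * f ⟨ k′ ℕ.* A / a ⟩)
    ⟨⟩-twisted-sum A {a} {_} {g} {b′} {_} {k′} ≡.refl ≡.refl coprime = begin
      sumTo (b′ ℕ.* g) (λ r → f ⟨ k′ ℕ.* g ℕ.* (A ℕ.+ r ℕ.* a) / a ℕ.* (b′ ℕ.* g) ⟩)
        ≈⟨ sumTo-cong (b′ ℕ.* g) (λ {r} _ → cancel-g r) ⟩
      sumTo (b′ ℕ.* g) (λ r → h (k′ ℕ.* r))
        ≡⟨ ≡.cong (λ N → sumTo N (λ r → h (k′ ℕ.* r))) (ℕ.*-comm b′ g) ⟩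
      sumTo (g ℕ.* b′) (λ r → h (k′ ℕ.* r))
        ≈⟨ sumTo-dilate g coprime h-periodic ⟩
      fromℕ g * sumTo b′ h
        ≈⟨ *-cong refl (⟨⟩-distribution (k′ ℕ.* A) a b′) ⟩
      fromℕ g * (ipow b′ m * f ⟨ k′ ℕ.* A / a ⟩) ∎
      where
      instance
        ab′≢0 : NonZero (a ℕ.* b′)
        ab′≢0 = m*n≢0 a b′

      h : ℕ → Carrier
      h s = f ⟨ k′ ℕ.* A ℕ.+ s ℕ.* a / a ℕ.* b′ ⟩

      cancel-g : ∀ r → f ⟨ k′ ℕ.* g ℕ.* (A ℕ.+ r ℕ.* a) / a ℕ.* (b′ ℕ.* g) ⟩ ≈ h (k′ ℕ.* r)
      cancel-g r = ⟨⟩-cross f (k′ ℕ.* g ℕ.* (A ℕ.+ r ℕ.* a)) (a ℕ.* (b′ ℕ.* g))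
                              (k′ ℕ.* A ℕ.+ k′ ℕ.* r ℕ.* a) (a ℕ.* b′) (identity k′ g A r a b′)
        where
        identity : ∀ k′ g A r a b′ → k′ ℕ.* g ℕ.* (A ℕ.+ r ℕ.* a) ℕ.* (a ℕ.* b′) ≡
                                    (k′ ℕ.* A ℕ.+ k′ ℕ.* r ℕ.* a) ℕ.* (a ℕ.* (b′ ℕ.* g))
        identity = solve-∀

      h-periodic : Periodic b′ h
      h-periodic .shift s = begin
        h (b′ ℕ.+ s)                                      ≡⟨ ≡.cong (λ e → f ⟨ e / a ℕ.* b′ ⟩) (identity (k′ ℕ.* A) b′ s a) ⟩
        f ⟨ a ℕ.* b′ ℕ.+ (k′ ℕ.* A ℕ.+ s ℕ.* a) / a ℕ.* b′ ⟩ ≈⟨ ⟨⟩-periodic (a ℕ.* b′) .shift (k′ ℕ.* A ℕ.+ s ℕ.* a) ⟩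
        h s                                               ∎
        where
        identity : ∀ p b′ s a → p ℕ.+ (b′ ℕ.+ s) ℕ.* a ≡ a ℕ.* b′ ℕ.+ (p ℕ.+ s ℕ.* a)
        identity = solve-∀

module DivisorPairs (n a : ℕ) .{{n≢0 : NonZero n}} where
  open import Data.Nat using (_*_)
  open import Data.Nat.GCD using (gcd; gcd[m,n]∣m; gcd[m,n]∣n)
  open import Data.Nat.Divisibility using (divides; quotient; ∣-trans; ∣⇒≤)
  open import Data.Nat.DivMod using (m/n*n≡m; /-congʳ; m/n≤m)
  open import Algebra.Properties.CommutativeSemigroup ℕ.*-commutativeSemigroup
    using (x∙yz≈yx∙z; xy∙z≈yz∙x; xy∙z≈xz∙y; xy∙z≈y∙zx; x∙yz≈z∙xy)
  open GcdCofactors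
  open ≡.≡-Reasoning

  -- As in sumDivisors, a divisor b of n is represented by b - 1. Then φ (b - 1 , k) = (g - 1 , k̂ (n/b))
  -- where g = gcd k b and k = k̂ g, and ψ is its inverse.
  Dom Cod : Pred (ℕ × ℕ) 0ℓ
  Dom (x , k) = suc x ∣ n × k < a * suc x
  Cod (y , t) = suc y ∣ n × t < n / suc y * a

  Dom? : Decidable Dom
  Dom? (x , k) = suc x ∣? n ×-dec k <? a * suc x

  Cod? : Decidable Cod
  Cod? (y , t) = suc y ∣? n ×-dec t <? n / suc y * a

  φ ψ : ℕ × ℕ → ℕ × ℕ
  φ (x , k) = pred (gcd k (suc x)) , quotient (gcd[m,n]∣m k (suc x)) * (n / suc x)
  ψ (y , t) = pred (suc y * quotient (gcd[m,n]∣n t (n / suc y))) , suc y * quotient (gcd[m,n]∣m t (n / suc y))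

  φ-cofactors : ∀ {x k g b′ k′} → suc x ≡ b′ * g → k ≡ k′ * g → Coprime k′ b′ →
    φ (x , k) ≡ (pred g , k′ * (n / suc x))
  φ-cofactors {x} {k} {g} {b′} {k′} b≡ k≡ coprime =
    ≡.cong₂ _,_ (≡.cong pred gcd≡g) (≡.cong (_* (n / suc x)) k̂≡k′)
    where
    gcd≡g : gcd k (suc x) ≡ g
    gcd≡g = gcd-cofactors {u = k′} {b′} k≡ b≡ coprime
    k̂≡k′ : quotient (gcd[m,n]∣m k (suc x)) ≡ k′
    k̂≡k′ = quotient-unique ⦃ gcd-nonZeroʳ k (suc x) ⦄ (gcd[m,n]∣m k (suc x))
             (≡.trans k≡ (≡.cong (k′ *_) (≡.sym gcd≡g)))

  ψ-cofactors : ∀ {y t e b′ k′} .{{_ : NonZero e}} → n / suc y ≡ b′ * e → t ≡ k′ * e → Coprime k′ b′ →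
    ψ (y , t) ≡ (pred (suc y * b′) , suc y * k′)
  ψ-cofactors {y} {t} {e} {b′} {k′} N≡ t≡ coprime =
    ≡.cong₂ _,_
      (≡.cong (λ z → pred (suc y * z)) (quotient-unique {u = b′} ⦃ gcd≢0 ⦄ (gcd[m,n]∣n t N) (cofactor b′ N≡)))
      (≡.cong (suc y *_) (quotient-unique ⦃ gcd≢0 ⦄ (gcd[m,n]∣m t N) (cofactor k′ t≡)))
    where
    N : ℕ
    N = n / suc y
    gcd≡e : gcd t N ≡ e
    gcd≡e = gcd-cofactors {u = k′} {b′} t≡ N≡ coprime
    gcd≢0 : NonZero (gcd t N)
    gcd≢0 = ℕ.≢-nonZero (λ gcd≡0 → ℕ.≢-nonZero⁻¹ e (≡.trans (≡.sym gcd≡e) gcd≡0))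
    cofactor : ∀ {m} q → m ≡ q * e → m ≡ q * gcd t N
    cofactor q m≡qe = ≡.trans m≡qe (≡.cong (q *_) (≡.sym gcd≡e))

  module DomFacts {x k : ℕ} (b∣n : suc x ∣ n) where
    open Cofactors k (suc x) public

    c : ℕ
    c = n / suc x

    c≢0 : NonZero c
    c≢0 = nonZero-factorˡ c (suc x) ⦃ n≢0 ⦄ (≡.sym (m/n*n≡m b∣n))

    n/g≡b̂c : n / suc (pred g) ≡ b̂ * c
    n/g≡b̂c = ≡.trans (/-congʳ ⦃ _ ⦄ ⦃ g≢0 ⦄ (ℕ.suc-pred g ⦃ g≢0 ⦄)) (m≡q*d⇒m/d≡q ⦃ g≢0 ⦄ n≡)
      where
      n≡ : n ≡ b̂ * c * g
      n≡ = begin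
        n           ≡⟨ m/n*n≡m b∣n ⟨
        c * suc x   ≡⟨ ≡.cong (c *_) b≡b̂g ⟩
        c * (b̂ * g) ≡⟨ x∙yz≈yx∙z c b̂ g ⟩
        b̂ * c * g   ∎

  module CodFacts {y t : ℕ} (g∣n : suc y ∣ n) where
    N : ℕ
    N = n / suc y

    N≢0 : NonZero N
    N≢0 = nonZero-factorˡ N (suc y) ⦃ n≢0 ⦄ (≡.sym (m/n*n≡m g∣n))

    open Cofactors t N ⦃ N≢0 ⦄ public renaming (g to e; b≡b̂g to N≡b̂e; k≡k̂g to t≡k̂e)

    B : ℕ
    B = suc y * b̂

    B≢0 : NonZero B
    B≢0 = m*n≢0 (suc y) b̂ ⦃ _ ⦄ ⦃ b̂≢0 ⦄

    n≡eB : n ≡ e * B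
    n≡eB = begin
      n                 ≡⟨ m/n*n≡m g∣n ⟨
      N * suc y         ≡⟨ ≡.cong (_* suc y) N≡b̂e ⟩
      b̂ * e * suc y     ≡⟨ xy∙z≈y∙zx b̂ e (suc y) ⟩
      e * B             ∎

    n/B≡e : n / suc (pred B) ≡ e
    n/B≡e = ≡.trans (/-congʳ ⦃ _ ⦄ ⦃ B≢0 ⦄ (ℕ.suc-pred B ⦃ B≢0 ⦄)) (m≡q*d⇒m/d≡q ⦃ B≢0 ⦄ n≡eB)

  φ-∈ : ∀ {i} → Dom i → Cod (φ i)
  φ-∈ {x , k} (b∣n , k<ab) =
    ≡.subst (_∣ n) (≡.sym (ℕ.suc-pred g ⦃ g≢0 ⦄)) (∣-trans (gcd[m,n]∣n k (suc x)) b∣n) ,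
    ≡.subst (λ z → k̂ * c < z * a) (≡.sym n/g≡b̂c)
      (≡.subst (k̂ * c <_) (xy∙z≈yz∙x a b̂ c) (ℕ.*-monoˡ-< c ⦃ c≢0 ⦄ k̂<ab̂))
    where
    open DomFacts b∣n
    k̂<ab̂ : k̂ < a * b̂
    k̂<ab̂ = ℕ.*-cancelʳ-< g k̂ (a * b̂)
      (≡.subst₂ _<_ k≡k̂g (≡.trans (≡.cong (a *_) b≡b̂g) (≡.sym (ℕ.*-assoc a b̂ g))) k<ab)

  ψ-∈ : ∀ {j} → Cod j → Dom (ψ j)
  ψ-∈ {y , t} (g∣n , t<Na) =
    ≡.subst (_∣ n) (≡.sym (ℕ.suc-pred B ⦃ B≢0 ⦄)) (divides e n≡eB) ,
    ≡.subst (λ z → suc y * k̂ < a * z) (≡.sym (ℕ.suc-pred B ⦃ B≢0 ⦄))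
      (≡.subst (suc y * k̂ <_) (x∙yz≈z∙xy (suc y) b̂ a) (ℕ.*-monoʳ-< (suc y) k̂<b̂a))
    where
    open CodFacts g∣n
    k̂<b̂a : k̂ < b̂ * a
    k̂<b̂a = ℕ.*-cancelʳ-< e k̂ (b̂ * a)
      (≡.subst₂ _<_ t≡k̂e (≡.trans (≡.cong (_* a) N≡b̂e) (xy∙z≈xz∙y b̂ e a)) t<Na)

  ψ∘φ : ∀ {i} → Dom i → ψ (φ i) ≡ i
  ψ∘φ {x , k} (b∣n , _) = begin
    ψ (pred g , k̂ * c)
      ≡⟨ ψ-cofactors ⦃ c≢0 ⦄ n/g≡b̂c ≡.refl coprime ⟩
    pred (suc (pred g) * b̂) , suc (pred g) * k̂
      ≡⟨ ≡.cong (λ h → pred (h * b̂) , h * k̂) (ℕ.suc-pred g ⦃ g≢0 ⦄) ⟩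
    pred (g * b̂) , g * k̂
      ≡⟨ ≡.cong₂ _,_ (≡.cong pred (≡.trans b≡b̂g (ℕ.*-comm b̂ g))) (≡.trans k≡k̂g (ℕ.*-comm k̂ g)) ⟨
    x , k ∎
    where open DomFacts b∣n

  φ∘ψ : ∀ {j} → Cod j → φ (ψ j) ≡ j
  φ∘ψ {y , t} (g∣n , _) = begin
    φ (pred B , suc y * k̂)
      ≡⟨ φ-cofactors (≡.trans (ℕ.suc-pred B ⦃ B≢0 ⦄) (ℕ.*-comm (suc y) b̂)) (ℕ.*-comm (suc y) k̂)
                     coprime ⟩
    y , k̂ * (n / suc (pred B))
      ≡⟨ ≡.cong (λ z → y , k̂ * z) n/B≡e ⟩
    y , k̂ * e
      ≡⟨ ≡.cong (y ,_) t≡k̂e ⟨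
    y , t ∎
    where open CodFacts g∣n

  a*b≤a*n : ∀ {b} → b ∣ n → a * b ≤ a * n
  a*b≤a*n b∣n = ℕ.*-monoʳ-≤ a (∣⇒≤ b∣n)

  n/b*a≤a*n : ∀ b .{{_ : NonZero b}} → n / b * a ≤ a * n
  n/b*a≤a*n b = ℕ.≤-trans (ℕ.*-monoˡ-≤ a (m/n≤m n b)) (ℕ.≤-reflexive (ℕ.*-comm n a))

  Dom⊆Box : ∀ {i} → Dom i → InBox n (a * n) i
  Dom⊆Box (b∣n , k<ab) = ∣⇒≤ b∣n , ℕ.<-≤-trans k<ab (a*b≤a*n b∣n)

  Cod⊆Box : ∀ {j} → Cod j → InBox n (a * n) j
  Cod⊆Box {y , t} (g∣n , t<Na) = ∣⇒≤ g∣n , ℕ.<-≤-trans t<Na (n/b*a≤a*n (suc y))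

  divisorPairBijection : Bijection (InBox n (a * n) ∩ Dom) (InBox n (a * n) ∩ Cod)
  divisorPairBijection = record
    { to = φ
    ; from = ψ
    ; to-∈ = λ (_ , i∈) → Cod⊆Box (φ-∈ i∈) , φ-∈ i∈
    ; from-∈ = λ (_ , j∈) → Dom⊆Box (ψ-∈ j∈) , ψ-∈ j∈
    ; from∘to = ψ∘φ ∘ proj₂
    ; to∘from = φ∘ψ ∘ proj₂
    }

module DivisorSumIdentity {c ℓ} (R : ℚAlgebra c ℓ) (d : ℕ) (f : Fin d → ℚ → ℚAlgebra.Carrier R)
  (m : Fin d → ℤ) (n a : ℕ) .{{n≢0 : NonZero n}} .{{a≢0 : NonZero a}} (as : Fin d → ℕ)
  (f-dt : ℚAlgebra.DedekindType R f m) where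
  open ℚAlgebra R
  open import Relation.Binary.Reasoning.Setoid setoid
  open import Data.Nat.DivMod using (m/n*n≡m)
  open import Data.Nat.Tactic.RingSolver using (solve-∀)
  import Data.Integer.Tactic.RingSolver as ℤ-Solver
  open Sums R
  open PairSums R
  open Products R
  open Powers R
  open DedekindTypeFunctions R
  open GcdCofactors using (module Cofactors)
  open DivisorPairs n a

  instance
    a*[1+x]≢0 : ∀ {x} → NonZero (a ℕ.* suc x)
    a*[1+x]≢0 {x} = m*n≢0 a (suc x)

  M E : ℤ
  M = sumℤ d m
  E = + d ℤ.- + 1 ℤ.- M

  summand : (b : ℕ) → .{{NonZero b}} → Carrier
  summand b = ipow b (ℤ.- M) * sumTuples d b (λ r →
    S f (a ℕ.* b) ⦃ m*n≢0 a b ⦄ (λ j → n / b ℕ.* as j ℕ.+ r j ℕ.* a))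

  P : ℕ → Carrier
  P t = prodFin d (λ j → f j ⟨ t ℕ.* as j / a ⟩)

  H : ℕ × ℕ → Carrier
  H (y , t) = ipow (suc y) (+ d ℤ.- M) * P t

  P-periodic : Periodic a P
  P-periodic .shift i = prodFin-cong d λ j → begin
    f j ⟨ (a ℕ.+ i) ℕ.* as j / a ⟩       ≡⟨ ≡.cong (λ e → f j ⟨ e / a ⟩) (identity a i (as j)) ⟩
    f j ⟨ i ℕ.* as j ℕ.+ as j ℕ.* a / a ⟩ ≈⟨ periodic-multiple (⟨⟩-periodic {m = m j} (f-dt j) a) (i ℕ.* as j) (as j) ⟩
    f j ⟨ i ℕ.* as j / a ⟩               ∎
    where
    identity : ∀ a i u → (a ℕ.+ i) ℕ.* u ≡ i ℕ.* u ℕ.+ u ℕ.* a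
    identity = solve-∀

  twisted-product : ∀ x k (A : Fin d → ℕ) → let open Cofactors k (suc x) in
    ipow (suc x) (ℤ.- M) * prodFin d (λ j → sumTo (suc x) (λ r → f j ⟨ k ℕ.* (A j ℕ.+ r ℕ.* a) / a ℕ.* suc x ⟩))
      ≈ ipow g (+ d ℤ.- M) * prodFin d (λ j → f j ⟨ k̂ ℕ.* A j / a ⟩)
  twisted-product x k A = begin
    ipow (suc x) (ℤ.- M) * prodFin d (λ j → sumTo (suc x) (λ r → f j ⟨ k ℕ.* (A j ℕ.+ r ℕ.* a) / a ℕ.* suc x ⟩))
      ≈⟨ *-cong refl (prodFin-cong d λ j →
           ⟨⟩-twisted-sum {m = m j} (f-dt j) (A j) {a} ⦃ a≢0 ⦄ ⦃ b̂≢0 ⦄ b≡b̂g k≡k̂g coprime) ⟩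
    ipow (suc x) (ℤ.- M) * prodFin d (λ j → fromℕ g * (ipow b̂ (m j) * Y j))
      ≈⟨ *-cong refl (trans (prodFin-distrib-* d _ _) (*-cong (prodFin-const d (fromℕ g))
           (trans (prodFin-distrib-* d _ _) (*-cong (prodFin-ipow d b̂ ⦃ b̂≢0 ⦄ m) refl)))) ⟩
    ipow (suc x) (ℤ.- M) * (pow (fromℕ g) d * (ipow b̂ M * prodFin d Y))
      ≈⟨ trans (*-assoc _ _ _) (*-cong refl (*-assoc _ _ _)) ⟨
    (ipow (suc x) (ℤ.- M) * (pow (fromℕ g) d * ipow b̂ M)) * prodFin d Y
      ≈⟨ *-cong (ipow-cancel-cofactor g b̂ ⦃ g≢0 ⦄ ⦃ b̂≢0 ⦄ (≡.trans b≡b̂g (ℕ.*-comm b̂ g)) d M) refl ⟩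
    ipow g (+ d ℤ.- M) * prodFin d Y ∎
    where
    open Cofactors k (suc x)
    Y : Fin d → Carrier
    Y j = f j ⟨ k̂ ℕ.* A j / a ⟩

  summand≈ : ∀ x → summand (suc x) ≈ sumTo (a ℕ.* suc x) (λ k → H (φ (x , k)))
  summand≈ x = begin
    ipow b (ℤ.- M) * sumTuples d b (λ r → sumTo (a ℕ.* b) (λ k → prodFin d (λ j → h k j (r j))))
      ≈⟨ *-cong refl (sumTuples-comm d b (a ℕ.* b) _) ⟩
    ipow b (ℤ.- M) * sumTo (a ℕ.* b) (λ k → sumTuples d b (λ r → prodFin d (λ j → h k j (r j))))
      ≈⟨ *-cong refl (sumTo-cong (a ℕ.* b) λ {k} _ → sumTuples-prodFin d b (h k)) ⟩
    ipow b (ℤ.- M) * sumTo (a ℕ.* b) (λ k → prodFin d (λ j → sumTo b (h k j)))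
      ≈⟨ sumTo-distribˡ (a ℕ.* b) _ _ ⟩
    sumTo (a ℕ.* b) (λ k → ipow b (ℤ.- M) * prodFin d (λ j → sumTo b (h k j)))
      ≈⟨ sumTo-cong (a ℕ.* b) (λ {k} _ → trans (twisted-product x k (λ j → n/b ℕ.* as j)) (at-φ k)) ⟩
    sumTo (a ℕ.* b) (λ k → H (φ (x , k))) ∎
    where
    b n/b : ℕ
    b = suc x
    n/b = n / b
    h : ℕ → Fin d → ℕ → Carrier
    h k j r = f j ⟨ k ℕ.* (n/b ℕ.* as j ℕ.+ r ℕ.* a) / a ℕ.* b ⟩
    at-φ : ∀ k → let open Cofactors k b in
      ipow g (+ d ℤ.- M) * prodFin d (λ j → f j ⟨ k̂ ℕ.* (n/b ℕ.* as j) / a ⟩) ≈ H (φ (x , k))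
    at-φ k = *-cong (reflexive (≡.cong (λ e → ipow e (+ d ℤ.- M)) (≡.sym (ℕ.suc-pred g ⦃ g≢0 ⦄))))
      (prodFin-cong d λ j → reflexive (≡.cong (λ e → f j ⟨ e / a ⟩) (≡.sym (ℕ.*-assoc k̂ n/b (as j)))))
      where open Cofactors k b

  σ-term : ∀ y → suc y ∣ n → (fromℕ n * ipow (suc y) E) * S f a as ≈ sumTo (n / suc y ℕ.* a) (λ t → H (y , t))
  σ-term y g∣n = begin
    (fromℕ n * ipow g E) * sumTo a P
      ≡⟨ ≡.cong (λ z → (fromℕ z * ipow g E) * sumTo a P) (m/n*n≡m g∣n) ⟨
    (fromℕ (N ℕ.* g) * ipow g E) * sumTo a P
      ≈⟨ *-cong (trans (*-cong (fromℕ-homo-* N g) refl) (*-assoc _ _ _)) refl ⟩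
    (fromℕ N * (fromℕ g * ipow g E)) * sumTo a P
      ≈⟨ *-cong (*-cong refl (ipow-1+ g E)) refl ⟩
    (fromℕ N * ipow g (+ 1 ℤ.+ E)) * sumTo a P
      ≡⟨ ≡.cong (λ z → (fromℕ N * ipow g z) * sumTo a P) (identity (+ d) M) ⟩
    (fromℕ N * ipow g (+ d ℤ.- M)) * sumTo a P
      ≈⟨ trans (*-cong (*-comm _ _) refl) (*-assoc _ _ _) ⟩
    ipow g (+ d ℤ.- M) * (fromℕ N * sumTo a P)
      ≈⟨ *-cong refl (sumTo-periodic N P-periodic) ⟨
    ipow g (+ d ℤ.- M) * sumTo (N ℕ.* a) P
      ≈⟨ sumTo-distribˡ (N ℕ.* a) _ P ⟩
    sumTo (N ℕ.* a) (λ t → H (y , t)) ∎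
    where
    g N : ℕ
    g = suc y
    N = n / g
    identity : ∀ D M → + 1 ℤ.+ (D ℤ.- + 1 ℤ.- M) ≡ D ℤ.- M
    identity = ℤ-Solver.solve-∀

  divisor-sum≈sum² : sumDivisors n summand ≈ sum² n (a ℕ.* n) (λ i → if does (Dom? i) then H (φ i) else 0#)
  divisor-sum≈sum² = trans (sumDivisors≈sumTo n summand summand≈)
    (sumTo-dependent≈sum² (λ x → suc x ∣? n) n (a ℕ.* n) (λ x → a ℕ.* suc x) (λ x k → H (φ (x , k))) a*b≤a*n)

  σ-sum≈sum² : fromℕ n * σ E n * S f a as ≈ sum² n (a ℕ.* n) (λ j → if does (Cod? j) then H j else 0#)
  σ-sum≈sum² = begin
    fromℕ n * σ E n * S f a as
      ≈⟨ *-cong (*-cong refl (sumDivisors≈sumTo n (λ b → ipow b E) (λ _ → refl))) refl ⟩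
    fromℕ n * sumTo n (λ y → if does (suc y ∣? n) then ipow (suc y) E else 0#) * S f a as
      ≈⟨ trans (*-cong (sumTo-distribˡ n _ _) refl) (sumTo-distribʳ n _ _) ⟩
    sumTo n (λ y → fromℕ n * (if does (suc y ∣? n) then ipow (suc y) E else 0#) * S f a as)
      ≈⟨ sumTo-cong n (λ {y} _ → if-does-cong (suc y ∣? n) (λ z → fromℕ n * z * S f a as)
                                   (trans (*-cong (zeroʳ _) refl) (zeroˡ _)) (σ-term y)) ⟩
    sumTo n (λ y → if does (suc y ∣? n) then sumTo (n / suc y ℕ.* a) (λ t → H (y , t)) else 0#)
      ≈⟨ sumTo-dependent≈sum² (λ y → suc y ∣? n) n (a ℕ.* n) (λ y → n / suc y ℕ.* a) (λ y t → H (y , t))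
                              (λ {y} _ → n/b*a≤a*n (suc y)) ⟩
    sum² n (a ℕ.* n) (λ j → if does (Cod? j) then H j else 0#) ∎

theorem11 : ∀ {c ℓ} (R : ℚAlgebra c ℓ) → let open ℚAlgebra R in
    (d : ℕ) (f : Fin d → ℚ → Carrier) (m : Fin d → ℤ)
    (n a : ℕ) .{{_ : NonZero n}} .{{_ : NonZero a}} (as : Fin d → ℕ) →
    DedekindType f m →
    sumDivisors n (λ b .{{nzb}} → ipow b (ℤ.- sumℤ d m) *
        sumTuples d b (λ r →
          S f (a ℕ.* b) {{m*n≢0 a b}} (λ j → (n / b) ℕ.* as j ℕ.+ r j ℕ.* a)))
      ≈ fromℕ n * σ (+ d ℤ.- + 1 ℤ.- sumℤ d m) n * S f a as
theorem11 R d f m n a as f-dt =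
  trans divisor-sum≈sum² (trans (sum²-reindex Dom? Cod? divisorPairBijection H) (sym σ-sum≈sum²))
  where
  open ℚAlgebra R using (trans; sym)
  open PairSums R using (sum²-reindex)
  open DivisorPairs n a using (Dom?; Cod?; divisorPairBijection)
  open DivisorSumIdentity R d f m n a as f-dt using (H; divisor-sum≈sum²; σ-sum≈sum²)
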